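{- Two finite subsets $A,D\subseteq\mathsf{I}\mathbb{Q}$ are separated if and only if $\bigsqcup A$ exists in $\mathsf{I}\mathbb{Q}$ and is not a singleton (i.e. writing $\bigsqcup A=[a,b]$ we have $a<b$), and $d\not\sqsubseteq\bigsqcup A$ for all $d\in D$.
   Context: Work constructively; $\tilde\exists x.A$ abbreviates $\neg\forall x.\neg A$. $\mathsf{I}\mathbb{Q}=\{[p,q]\mid p,q\in\mathbb Q,\ p\le q\}$ ordered by $[p,q]\sqsubseteq[p',q']$ iff $p\le p'\le q'\le q$. A chain is a sequence $(x_n)$ with $x_n\sqsubseteq x_{n+1}$; $\beta\ll\gamma$ in $\mathsf{I}\mathbb{Q}$ means: for every chain $(x_n)$ in $\mathsf{I}\mathbb{Q}$ whose supremum exists in $\mathsf{I}\mathbb{Q}$ and satisfies $\gamma\sqsubseteq\bigsqcup_n x_n$, there weakly exists $n$ with $\beta\sqsubseteq x_n$. Two subsets $A,D$ are separated if there weakly exists $\omega\in\mathsf{I}\mathbb{Q}$ with $a\ll\omega$ for all $a\in A$ and $\neg(d\ll\omega)$ for all $d\in D$. -}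

module Defs where

open import Data.Nat using (ℕ; suc)
open import Data.Rational using (ℚ; _≤_; _<_)
open import Data.Product using (Σ; _×_)
open import Data.List using (List; [])
open import Data.List.Membership.Propositional using (_∈_)
open import Relation.Nullary using (¬_)

record IQ : Set where
  constructor [_,_]⟨_⟩
  field
    lo : ℚ
    hi : ℚ
    lo≤hi : lo ≤ hi
open IQ public

_⊑_ : IQ → IQ → Set
x ⊑ y = (lo x ≤ lo y) × (lo y ≤ hi y) × (hi y ≤ hi x)

infix 4 _⊑_ _≪_

IsChain : (ℕ → IQ) → Set
IsChain x = ∀ n → x n ⊑ x (suc n)

IsSupSeq : (ℕ → IQ) → IQ → Set
IsSupSeq x s = (∀ n → x n ⊑ s) × (∀ u → (∀ n → x n ⊑ u) → s ⊑ u)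

∃̃ : {A : Set} → (A → Set) → Set
∃̃ {A} P = ¬ ((a : A) → ¬ P a)

_≪_ : IQ → IQ → Set
β ≪ γ = (x : ℕ → IQ) → IsChain x → (s : IQ) → IsSupSeq x s → γ ⊑ s →
        ∃̃ (λ n → β ⊑ x n)

IsSupFin : List IQ → IQ → Set
IsSupFin A s = (∀ a → a ∈ A → a ⊑ s) × (∀ u → (∀ a → a ∈ A → a ⊑ u) → s ⊑ u)

Separated : List IQ → List IQ → Set
Separated A D = ∃̃ (λ ω → (∀ a → a ∈ A → a ≪ ω) × (∀ d → d ∈ D → ¬ (d ≪ ω)))

module Submission where

-- The heart of the proof is the classical description of the way-below
-- relation on IQ:  β ≪ γ  iff  γ lies in the interior of β, i.e.
-- lo β < lo γ and hi γ < hi β  (written β ⊏ γ below).  Necessity uses the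
-- chain [lo γ - 1/(n+1), hi γ + 1/(n+1)], whose supremum is γ by the
-- Archimedean property of ℚ; sufficiency uses that the end points of a
-- supremum are approached by the chain (weakly, which is all ≪ asks for).
--
-- With this description both directions are order-theoretic:
--  * if ω separates A from D, then every a ∈ A satisfies a ⊏ ω, so the
--    hull [max lo, min hi] of A is a proper interval, it is the supremum of
--    A, and d ⊑ ⊔A would give d ⊏ ω, i.e. d ≪ ω;
--  * conversely, starting from a point strictly inside ⊔A we widen an
--    interval ω with ⊔A ⊏ ω one element of D at a time, so that no d ∈ D
--    satisfies d ⊏ ω; then ω separates A from D.

open import Defs
open import Data.Nat as ℕ using (ℕ; suc; zero)
import Data.Nat.Properties as ℕ
open import Data.Nat.Coprimality using (1-coprimeTo)
open import Data.Integer as ℤ using (+_; +[1+_]; -[1+_])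
open import Data.Rational using (ℚ; mkℚ; 0ℚ; _+_; _-_; -_; _<_; _≤_; _⊔_; _⊓_; *<*; *≤*)
open import Data.Rational.Properties
  using ( ≤-refl; ≤-trans; <-trans; <⇒≤; ≤-<-trans; <-≤-trans; <-irrefl; ≮⇒≥
        ; _<?_; <-dense; ≤-decTotalOrder; ⊓-sel; ⊔-sel; p⊓q≤p; p⊓q≤q; p≤p⊔q; p≤q⊔p
        ; +-monoʳ-<; +-monoˡ-<; +-monoʳ-≤; neg-antimono-<; neg-antimono-≤
        ; +-inverseʳ; +-identityʳ )
open import Data.Rational.Solver using (module +-*-Solver)
open import Relation.Binary.Bundles using (DecTotalOrder)
import Data.List.Extrema
open import Data.List using (List; []; _∷_)
open import Data.List.Membership.Propositional using (_∈_)
open import Data.List.Relation.Unary.Any using (here; there)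
import Data.List.Relation.Unary.All as All
open import Data.Product using (Σ; ∃; _×_; _,_; proj₁; proj₂; uncurry)
open import Data.Sum using (_⊎_; inj₁; inj₂)
open import Data.Empty using (⊥-elim)
open import Relation.Nullary using (¬_; Dec; yes; no)
open import Relation.Nullary.Decidable using (decidable-stable; _×-dec_; map′)
open import Relation.Binary.PropositionalEquality using (_≡_; refl; sym; subst)

module Extrema = Data.List.Extrema (DecTotalOrder.totalOrder ≤-decTotalOrder)
open Extrema using (argmax; argmin)
open +-*-Solver using (solve; _:+_; _:-_; _:=_)

<⇒≱ : ∀ {p q : ℚ} → p < q → ¬ (q ≤ p)
<⇒≱ p<q q≤p = <-irrefl refl (<-≤-trans p<q q≤p)

<-⊓ : ∀ {r p q} → r < p → r < q → r < p ⊓ q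
<-⊓ {r} {p} {q} r<p r<q with ⊓-sel p q
... | inj₁ eq = subst (r <_) (sym eq) r<p
... | inj₂ eq = subst (r <_) (sym eq) r<q

⊔-< : ∀ {r p q} → p < r → q < r → p ⊔ q < r
⊔-< {r} {p} {q} p<r q<r with ⊔-sel p q
... | inj₁ eq = subst (_< r) (sym eq) p<r
... | inj₂ eq = subst (_< r) (sym eq) q<r

-- ε n = 1/(n+1), a decreasing sequence of positive rationals tending to 0.
ε : ℕ → ℚ
ε n = mkℚ (+ 1) n (1-coprimeTo _)

ε-pos : ∀ n → 0ℚ < ε n
ε-pos n = *<* (ℤ.+<+ (ℕ.s≤s ℕ.z≤n))

ε-antitone : ∀ n → ε (suc n) ≤ ε n
ε-antitone n = *≤* (ℤ.+≤+ (ℕ.n≤1+n _))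

archimedean : ∀ r → 0ℚ < r → ∃ λ n → ε n < r
archimedean (mkℚ +[1+ k ] d _) _ =
  suc d , *<* (ℤ.+<+ (ℕ.s≤s (ℕ.s≤s (ℕ.+-monoʳ-≤ d ℕ.z≤n))))
archimedean (mkℚ (+ zero) _ _) (*<* (ℤ.+<+ ()))
archimedean (mkℚ -[1+ _ ] _ _) (*<* ())

+-cancel : ∀ p q → (p + q) - q ≡ p
+-cancel = solve 2 (λ p q → (p :+ q) :- q := p) refl

+-fill : ∀ p q → p + (q - p) ≡ q
+-fill = solve 2 (λ p q → p :+ (q :- p) := q) refl

archimedean-gap : ∀ {a b} → a < b → ∃ λ n → a + ε n < b
archimedean-gap {a} {b} a<b with archimedean (b - a) 0<b-a
  where
  0<b-a : 0ℚ < b - a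
  0<b-a = subst (_< b - a) (+-inverseʳ a) (+-monoˡ-< (- a) a<b)
... | n , εn<b-a = n , subst (a + ε n <_) (+-fill a b) (+-monoʳ-< a εn<b-a)

x-ε<x : ∀ x n → x - ε n < x
x-ε<x x n = subst (x - ε n <_) (+-identityʳ x) (+-monoʳ-< x (neg-antimono-< (ε-pos n)))

x<x+ε : ∀ x n → x < x + ε n
x<x+ε x n = subst (_< x + ε n) (+-identityʳ x) (+-monoʳ-< x (ε-pos n))

≤-from-below : ∀ {x y} → (∀ n → x - ε n ≤ y) → x ≤ y
≤-from-below {x} {y} h = ≮⇒≥ λ y<x →
  let (n , y+εn<x) = archimedean-gap y<x
  in <⇒≱ (subst (_< x - ε n) (+-cancel y (ε n)) (+-monoˡ-< (- ε n) y+εn<x)) (h n)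

≤-from-above : ∀ {x y} → (∀ n → y ≤ x + ε n) → y ≤ x
≤-from-above {x} {y} h = ≮⇒≥ λ x<y →
  let (n , x+εn<y) = archimedean-gap x<y in <⇒≱ x+εn<y (h n)

⊑-refl : ∀ x → x ⊑ x
⊑-refl x = ≤-refl , lo≤hi x , ≤-refl

⊑-trans : ∀ {x y z} → x ⊑ y → y ⊑ z → x ⊑ z
⊑-trans (xy₁ , _ , xy₃) (yz₁ , z-ok , yz₃) = ≤-trans xy₁ yz₁ , z-ok , ≤-trans yz₃ xy₃

chain-mono : ∀ x → IsChain x → ∀ {n k} → n ℕ.≤ k → x n ⊑ x k
chain-mono x ch {n} {k} n≤k = subst (λ j → x n ⊑ x j) (ℕ.m∸n+n≡m n≤k) (up (k ℕ.∸ n))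
  where
  up : ∀ d → x n ⊑ x (d ℕ.+ n)
  up zero = ⊑-refl (x n)
  up (suc d) = ⊑-trans {x n} {x (d ℕ.+ n)} {x (suc d ℕ.+ n)} (up d) (ch (d ℕ.+ n))

-- β ⊏ γ: γ lies in the interior of β.  This turns out to be exactly ≪.
infix 4 _⊏_
record _⊏_ (β γ : IQ) : Set where
  constructor interior
  field
    lo<lo : lo β < lo γ
    hi<hi : hi γ < hi β
open _⊏_

-- ⊏ is decidable, hence stable under double negation.
_⊏?_ : ∀ β γ → Dec (β ⊏ γ)
β ⊏? γ = map′ (λ (l , h) → interior l h) (λ β⊏γ → lo<lo β⊏γ , hi<hi β⊏γ)
              ((lo β <? lo γ) ×-dec (hi γ <? hi β))

⊏⇒⊑ : ∀ {β γ} → β ⊏ γ → β ⊑ γ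
⊏⇒⊑ {γ = γ} (interior l h) = <⇒≤ l , lo≤hi γ , <⇒≤ h

⊑-⊏-trans : ∀ {α β γ} → α ⊑ β → β ⊏ γ → α ⊏ γ
⊑-⊏-trans (l , _ , h) (interior l' h') = interior (≤-<-trans l l') (<-≤-trans h' h)

⊏-⊑-trans : ∀ {α β γ} → α ⊏ β → β ⊑ γ → α ⊏ γ
⊏-⊑-trans (interior l h) (l' , _ , h') = interior (<-≤-trans l l') (≤-<-trans h' h)

⋢-cases : ∀ {d s} → ¬ (d ⊑ s) → (lo s < lo d) ⊎ (hi d < hi s)
⋢-cases {d} {s} d⋢s with lo s <? lo d | hi d <? hi s
... | yes l | _     = inj₁ l
... | no _  | yes h = inj₂ h
... | no l  | no h  = ⊥-elim (d⋢s (≮⇒≥ l , lo≤hi s , ≮⇒≥ h))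

approx : IQ → ℕ → IQ
approx γ n = [ lo γ - ε n , hi γ + ε n ]⟨ ≤-trans (<⇒≤ (x-ε<x (lo γ) n))
                                           (≤-trans (lo≤hi γ) (<⇒≤ (x<x+ε (hi γ) n))) ⟩

approx⊏ : ∀ γ n → approx γ n ⊏ γ
approx⊏ γ n = interior (x-ε<x (lo γ) n) (x<x+ε (hi γ) n)

approx-chain : ∀ γ → IsChain (approx γ)
approx-chain γ n = +-monoʳ-≤ (lo γ) (neg-antimono-≤ (ε-antitone n))
                 , lo≤hi (approx γ (suc n))
                 , +-monoʳ-≤ (hi γ) (ε-antitone n)

-- Its supremum is γ: this is where the Archimedean property enters.
approx-sup : ∀ γ → IsSupSeq (approx γ) γ
approx-sup γ = (λ n → ⊏⇒⊑ (approx⊏ γ n))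
             , λ u ub → ≤-from-below (λ n → proj₁ (ub n)) , lo≤hi u
                      , ≤-from-above (λ n → proj₂ (proj₂ (ub n)))

-- If β ≪ γ, some approx γ n weakly refines β, forcing β ⊏ γ.
≪⇒⊏ : ∀ {β γ} → β ≪ γ → β ⊏ γ
≪⇒⊏ {β} {γ} β≪γ = decidable-stable (β ⊏? γ) λ β⋤γ →
  β≪γ (approx γ) (approx-chain γ) γ (approx-sup γ) (⊑-refl γ)
      (λ n β⊑xn → β⋤γ (⊑-⊏-trans β⊑xn (approx⊏ γ n)))

sup-lo-approached : ∀ x s {r} → IsSupSeq x s → r < lo s → ∃̃ λ n → r ≤ lo (x n)
sup-lo-approached x s {r} (upper , least) r<s none =
  <⇒≱ r<s (proj₁ (least u below-u))
  where
  u : IQ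
  u = [ r , hi s ]⟨ ≤-trans (<⇒≤ r<s) (lo≤hi s) ⟩
  below-u : ∀ n → x n ⊑ u
  below-u n = ≮⇒≥ (λ r<xn → none n (<⇒≤ r<xn)) , lo≤hi u , proj₂ (proj₂ (upper n))

sup-hi-approached : ∀ x s {r} → IsSupSeq x s → hi s < r → ∃̃ λ n → hi (x n) ≤ r
sup-hi-approached x s {r} (upper , least) s<r none =
  <⇒≱ s<r (proj₂ (proj₂ (least u below-u)))
  where
  u : IQ
  u = [ lo s , r ]⟨ ≤-trans (lo≤hi s) (<⇒≤ s<r) ⟩
  below-u : ∀ n → x n ⊑ u
  below-u n = proj₁ (upper n) , lo≤hi u , ≮⇒≥ (λ xn<r → none n (<⇒≤ xn<r))

-- If β ⊏ γ ⊑ ⊔x, both ends of β are eventually passed by the chain, so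
-- some member refines β.
⊏⇒≪ : ∀ {β γ} → β ⊏ γ → β ≪ γ
⊏⇒≪ {β} β⊏γ x ch s sup γ⊑s none =
  sup-lo-approached x s sup (lo<lo β⊏s) λ n lo-ok →
  sup-hi-approached x s sup (hi<hi β⊏s) λ m hi-ok →
  none (n ℕ.⊔ m) ( ≤-trans lo-ok (proj₁ (chain-mono x ch (ℕ.m≤m⊔n n m)))
                 , lo≤hi (x (n ℕ.⊔ m))
                 , ≤-trans (proj₂ (proj₂ (chain-mono x ch (ℕ.m≤n⊔m n m)))) hi-ok )
  where
  β⊏s : β ⊏ s
  β⊏s = ⊏-⊑-trans β⊏γ γ⊑s

module _ {A : Set} (f : A → ℚ) (a : A) (as : List A) where

  argmax-∈ : argmax f a as ∈ a ∷ as
  argmax-∈ with Extrema.argmax-sel f a as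
  ... | inj₁ eq = subst (_∈ a ∷ as) (sym eq) (here refl)
  ... | inj₂ m  = there m

  ≤-argmax : ∀ x → x ∈ a ∷ as → f x ≤ f (argmax f a as)
  ≤-argmax x (here refl) = Extrema.f[⊥]≤f[argmax] {f = f} a as
  ≤-argmax x (there m)   = All.lookup (Extrema.f[xs]≤f[argmax] {f = f} a as) m

  argmin-∈ : argmin f a as ∈ a ∷ as
  argmin-∈ with Extrema.argmin-sel f a as
  ... | inj₁ eq = subst (_∈ a ∷ as) (sym eq) (here refl)
  ... | inj₂ m  = there m

  argmin-≤ : ∀ x → x ∈ a ∷ as → f (argmin f a as) ≤ f x
  argmin-≤ x (here refl) = Extrema.f[argmin]≤f[⊤] {f = f} a as
  argmin-≤ x (there m)   = All.lookup (Extrema.f[argmin]≤f[xs] {f = f} a as) m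

maxLo minHi : IQ → List IQ → ℚ
maxLo a as = lo (argmax lo a as)
minHi a as = hi (argmin hi a as)

hull-sup : ∀ a as (ok : maxLo a as ≤ minHi a as) →
           IsSupFin (a ∷ as) [ maxLo a as , minHi a as ]⟨ ok ⟩
hull-sup a as ok = (λ x x∈ → ≤-argmax lo a as x x∈ , ok , argmin-≤ hi a as x x∈)
                 , λ u ub → proj₁ (ub _ (argmax-∈ lo a as)) , lo≤hi u
                          , proj₂ (proj₂ (ub _ (argmin-∈ hi a as)))

hull-⊏ : ∀ a as ω → (∀ x → x ∈ a ∷ as → x ⊏ ω) → (maxLo a as < lo ω) × (hi ω < minHi a as)
hull-⊏ a as ω all⊏ = lo<lo (all⊏ _ (argmax-∈ lo a as)) , hi<hi (all⊏ _ (argmin-∈ hi a as))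

Separator : IQ → List IQ → Set
Separator s L = Σ IQ λ ω → (s ⊏ ω) × (∀ d → d ∈ L → ¬ (d ⊏ ω))

avoid-widen : ∀ {ω ω' L} → ω' ⊑ ω → (∀ d → d ∈ L → ¬ (d ⊏ ω)) → ∀ d → d ∈ L → ¬ (d ⊏ ω')
avoid-widen ω'⊑ω avoid d d∈ d⊏ω' = avoid d d∈ (⊏-⊑-trans d⊏ω' ω'⊑ω)

avoid-∷ : ∀ {ω d L} → ¬ (d ⊏ ω) → (∀ x → x ∈ L → ¬ (x ⊏ ω)) → ∀ x → x ∈ d ∷ L → ¬ (x ⊏ ω)
avoid-∷ d-ok L-ok x (here refl) = d-ok
avoid-∷ d-ok L-ok x (there m)   = L-ok x m

separator-[] : ∀ {s} → lo s < hi s → Separator s []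
separator-[] lt with <-dense lt
... | c , s<c , c<s = [ c , c ]⟨ ≤-refl ⟩ , interior s<c c<s , λ _ ()

-- A new element d sticking out of s on the left (right) is dealt with by
-- moving the left (right) end of ω to the left end (right end) of d.
separator-∷ : ∀ {s d L} → ¬ (d ⊑ s) → Separator s L → Separator s (d ∷ L)
separator-∷ {s} {d} d⋢s (ω , interior s<ω ω<s , avoid) with ⋢-cases {d} {s} d⋢s
... | inj₁ s<d = ω' , interior (<-⊓ s<ω s<d) ω<s
               , avoid-∷ (λ d⊏ω' → <⇒≱ (lo<lo d⊏ω') (p⊓q≤q (lo ω) (lo d)))
                         (avoid-widen (p⊓q≤p (lo ω) (lo d) , lo≤hi ω , ≤-refl) avoid)
  where
  ω' : IQ
  ω' = [ lo ω ⊓ lo d , hi ω ]⟨ ≤-trans (p⊓q≤p (lo ω) (lo d)) (lo≤hi ω) ⟩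
... | inj₂ d<s = ω' , interior s<ω (⊔-< ω<s d<s)
               , avoid-∷ (λ d⊏ω' → <⇒≱ (hi<hi d⊏ω') (p≤q⊔p (hi ω) (hi d)))
                         (avoid-widen (≤-refl , lo≤hi ω , p≤p⊔q (hi ω) (hi d)) avoid)
  where
  ω' : IQ
  ω' = [ lo ω , hi ω ⊔ hi d ]⟨ ≤-trans (lo≤hi ω) (p≤p⊔q (hi ω) (hi d)) ⟩

separator : ∀ s L → lo s < hi s → (∀ d → d ∈ L → ¬ (d ⊑ s)) → Separator s L
separator s []      lt _  = separator-[] lt
separator s (d ∷ L) lt nd =
  separator-∷ (nd d (here refl)) (separator s L lt (λ x m → nd x (there m)))

SupCondition : List IQ → List IQ → Set
SupCondition A D = Σ IQ (λ s → IsSupFin A s × (lo s < hi s) × (∀ d → d ∈ D → ¬ (d ⊑ s)))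

separated⇒sup : ∀ a as D → Separated (a ∷ as) D → SupCondition (a ∷ as) D
separated⇒sup a as D sep = s , hull-sup a as (<⇒≤ M<m) , M<m , d⋢s
  where
  inside : ∀ ω → (∀ x → x ∈ a ∷ as → x ≪ ω) → (maxLo a as < lo ω) × (hi ω < minHi a as)
  inside ω all≪ = hull-⊏ a as ω (λ x x∈ → ≪⇒⊏ (all≪ x x∈))
  M<m : maxLo a as < minHi a as
  M<m = decidable-stable (maxLo a as <? minHi a as) λ M≮m → sep λ ω (all≪ , _) →
    let (M<ω , ω<m) = inside ω all≪ in M≮m (<-trans M<ω (≤-<-trans (lo≤hi ω) ω<m))
  s : IQ
  s = [ maxLo a as , minHi a as ]⟨ <⇒≤ M<m ⟩
  d⋢s : ∀ d → d ∈ D → ¬ (d ⊑ s)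
  d⋢s d d∈ d⊑s = sep λ ω (all≪ , none≪) →
    none≪ d d∈ (⊏⇒≪ {d} {ω} (⊑-⊏-trans {β = s} d⊑s (uncurry interior (inside ω all≪))))

sup⇒separated : ∀ {A} D s → (∀ a → a ∈ A → a ⊑ s) → lo s < hi s →
                (∀ d → d ∈ D → ¬ (d ⊑ s)) → Separated A D
sup⇒separated D s upper lt nd k with separator s D lt nd
... | ω , s⊏ω , avoid = k ω ( (λ a a∈ → ⊏⇒≪ {a} {ω} (⊑-⊏-trans (upper a a∈) s⊏ω))
                            , (λ d d∈ d≪ω → avoid d d∈ (≪⇒⊏ d≪ω)) )

lemma5p4 : (A D : List IQ) → ¬ (A ≡ []) →
    (Separated A D →
      Σ IQ (λ s → IsSupFin A s × (lo s < hi s) × (∀ d → d ∈ D → ¬ (d ⊑ s))))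
    × (Σ IQ (λ s → IsSupFin A s × (lo s < hi s) × (∀ d → d ∈ D → ¬ (d ⊑ s)))
      → Separated A D)
lemma5p4 []       D A≢[] = ⊥-elim (A≢[] refl)
lemma5p4 (a ∷ as) D _    = separated⇒sup a as D
                         , λ (s , sup , lt , nd) → sup⇒separated D s (proj₁ sup) lt nd
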